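{- Let $\mathcal C_n$ be the set of permutations in $\mathfrak S_n$ avoiding $2\text{ - }1\text{ - }3$ and $34\text{ - }21$. Label each $\pi\in\mathcal C_n$ by $(s(\pi),\pi_n)$. Then $1\in\mathcal C_1$ has label $(0,1)$, and for $\pi\in\mathcal C_n$ with label $(s,r)$ the multiset of labels of its children in $\mathcal C_{n+1}$ is: $(s+1,1),(s+1,2),\dots,(s+1,s),(s,s+1),(r,r+1)$ if $s<r$; and $(s+1,r+1)$ if $s>r$.
   Context: $\mathfrak S_n$ is the set of permutations $\pi=\pi_1\cdots\pi_n$ of $\{1,\dots,n\}$. $\pi$ avoids $2\text{ - }1\text{ - }3$ if there are no $i<j<k$ with $\pi_j<\pi_i<\pi_k$; $\pi$ avoids $34\text{ - }21$ if there are no $i$ and $k>i+1$ with $\pi_{k+1}<\pi_k<\pi_i<\pi_{i+1}$. For $\pi\in\mathfrak S_n$ and $j\in\{1,\dots,n+1\}$, appending $j$ to $\pi$ gives the permutation of $\{1,\dots,n+1\}$ whose first $n$ entries are $\pi_i$ if $\pi_i<j$ and $\pi_i+1$ if $\pi_i\ge j$, and whose last entry is $j$. The children of $\pi\in\mathcal C_n$ are the permutations obtained by appending some $j$ to $\pi$ that lie in $\mathcal C_{n+1}$. $s(\pi)=0$ if $\pi=n(n-1)\cdots21$, and otherwise $s(\pi)=\max\{\pi_i:\pi_i<\pi_{i+1}\}$. -}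

module Defs where

open import Data.Nat using (ℕ; zero; suc; _<_; _≤_; _<ᵇ_; _⊔_)
open import Data.Bool using (if_then_else_)
open import Data.List using (List; []; _∷_; _++_; map; upTo; length; foldr; [_])
open import Data.List.Relation.Binary.Permutation.Propositional using (_↭_)
open import Data.List.Relation.Unary.Unique.Propositional using (Unique)
open import Data.List.Membership.Propositional using (_∈_)
open import Data.Product using (_×_; _,_; Σ)
open import Relation.Nullary using (¬_)
open import Function.Bundles using (_⇔_)

-- Permutations of {1,…,n} in one-line notation, as lists of naturals.
-- π is a permutation of {1..n} iff it is a rearrangement of [1,2,…,n].
IsPerm : ℕ → List ℕ → Set
IsPerm n π = π ↭ map suc (upTo n)

-- 0-based entry lookup (default 0 out of range; only used in range).
at : List ℕ → ℕ → ℕ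
at []       _       = 0
at (x ∷ _)  zero    = x
at (_ ∷ xs) (suc i) = at xs i

Avoids213 : List ℕ → Set
Avoids213 π = ∀ i j k → i < j → j < k → k < length π →
  ¬ (at π j < at π i × at π i < at π k)

Avoids34-21 : List ℕ → Set
Avoids34-21 π = ∀ i k → suc i < k → suc k < length π →
  ¬ (at π (suc k) < at π k × at π k < at π i × at π i < at π (suc i))

C : ℕ → List ℕ → Set
C n π = IsPerm n π × Avoids213 π × Avoids34-21 π

append : List ℕ → ℕ → List ℕ
append π j = map (λ x → if x <ᵇ j then x else suc x) π ++ [ j ]

ascentTops : List ℕ → List ℕ
ascentTops []           = []
ascentTops (x ∷ [])     = []
ascentTops (x ∷ y ∷ xs) = (if x <ᵇ y then (x ∷_) else (λ l → l)) (ascentTops (y ∷ xs))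

s : List ℕ → ℕ
s π = foldr _⊔_ 0 (ascentTops π)

-- last entry π_n (default 0 for the empty list)
lastEntry : List ℕ → ℕ
lastEntry []           = 0
lastEntry (x ∷ [])     = x
lastEntry (x ∷ y ∷ xs) = lastEntry (y ∷ xs)

label : List ℕ → ℕ × ℕ
label π = s π , lastEntry π

-- js is exactly the list (without repetition) of those j ∈ {1,…,n+1}
-- for which appending j to π gives an element of C_{n+1}; the children of π
-- are then the permutations append π j, j ∈ js (distinct for distinct j).
ChildIndices : ℕ → List ℕ → List ℕ → Set
ChildIndices n π js =
  Unique js × (∀ j → (j ∈ js) ⇔ ((1 ≤ j × j ≤ suc n) × C (suc n) (append π j)))

ChildLabelsAre : ℕ → List ℕ → List (ℕ × ℕ) → Set
ChildLabelsAre n π L =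
  Σ (List ℕ) λ js → ChildIndices n π js × (map (λ j → label (append π j)) js ↭ L)

-- Appending j to π keeps the old entries in the same relative order (the
-- relabelling `bump j` is an order embedding), so a new pattern occurrence in
-- σ = append π j must use the new last entry.  For π ∈ C_n with last entry r:
--   * σ avoids 2-1-3  iff  j ≤ r+1, because the larger entry of every
--     inversion of π exceeds r, while r+1 sits before r whenever r < n;
--   * σ avoids 34-21  iff  (r < s(π) → r < j), because for j ≤ r an ascent of
--     π above r exists exactly when r < s(π).
-- Moreover s(π) < r forces r = s(π)+1 (the entry r-1 must be an ascent top).
-- Finally s(σ) is bump j (s π), plus the new ascent r < r+1 when j = r+1.
-- The file develops, in order: the relabelling `bump`, positional facts about
-- `at`, the computation of s(append π j), permutations of {1..n}, the
-- structure of a fixed π ∈ C_n and of its children, and the theorem.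
module Submission where

open import Defs
open import Data.Bool using (true; false; if_then_else_)
open import Data.Nat using (ℕ; zero; suc; _+_; _⊔_; _<_; _≤_; _<ᵇ_; z≤n; s≤s; s≤s⁻¹; s<s; s<s⁻¹; _<?_)
open import Data.Nat.Properties
open import Data.List using (List; []; _∷_; _++_; map; upTo; length; foldr; [_])
open import Data.List.Properties using (length-++; length-map; upTo-∷ʳ; map-++; ++-assoc; map-cong-local; map-id)
open import Data.List.Relation.Unary.Any using (here; there)
open import Data.List.Relation.Unary.All as All using (All)
open import Data.List.Relation.Unary.AllPairs using ([]; _∷_)
open import Data.List.Relation.Unary.Unique.Propositional using (Unique)
import Data.List.Relation.Unary.Unique.Propositional.Properties as Unique
open import Data.List.Membership.Propositional using (_∈_)
open import Data.List.Membership.Propositional.Properties using (∈-map⁺; ∈-map⁻; ∈-upTo⁺; ∈-upTo⁻)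
open import Data.List.Relation.Binary.Permutation.Propositional
  using (_↭_; ↭-sym; ↭-refl; ↭-trans; ↭-reflexive; ↭⇒↭ₛ; swap; module PermutationReasoning)
open import Data.List.Relation.Binary.Permutation.Propositional.Properties using (∈-resp-↭; ++⁺ˡ; ++⁺ʳ; map⁺)
open import Relation.Binary.PropositionalEquality.Properties using (setoid)
open import Data.List.Relation.Binary.Permutation.Setoid.Properties (setoid ℕ) using (Unique-resp-↭)
open import Data.Product using (Σ; _×_; _,_; proj₁; proj₂)
open import Data.Sum using (_⊎_; inj₁; inj₂)
open import Function.Bundles using (_⇔_; mk⇔; Equivalence)
open import Relation.Nullary using (yes; no; contradiction)
open import Relation.Nullary.Reflects using (ofʸ; ofⁿ)
open import Relation.Binary.Definitions using (tri<; tri≈; tri>)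
open import Relation.Binary.PropositionalEquality
  using (_≡_; _≢_; refl; sym; trans; cong; cong₂; subst; subst₂; module ≡-Reasoning)

<ᵇ-true : ∀ {x y} → x < y → (x <ᵇ y) ≡ true
<ᵇ-true {x} {y} x<y with x <ᵇ y | <ᵇ-reflects-< x y
... | true  | _       = refl
... | false | ofⁿ x≮y = contradiction x<y x≮y

<ᵇ-false : ∀ {x y} → y ≤ x → (x <ᵇ y) ≡ false
<ᵇ-false {x} {y} y≤x with x <ᵇ y | <ᵇ-reflects-< x y
... | true  | ofʸ x<y = contradiction y≤x (<⇒≱ x<y)
... | false | _       = refl

bump : ℕ → ℕ → ℕ
bump j x = if x <ᵇ j then x else suc x

bump-below : ∀ {j x} → x < j → bump j x ≡ x
bump-below x<j rewrite <ᵇ-true x<j = refl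

bump-above : ∀ {j x} → j ≤ x → bump j x ≡ suc x
bump-above j≤x rewrite <ᵇ-false j≤x = refl

bump-mono-< : ∀ j {x y} → x < y → bump j x < bump j y
bump-mono-< j {x} {y} x<y with x <? j | y <? j
... | yes x<j | yes y<j rewrite bump-below x<j | bump-below y<j = x<y
... | yes x<j | no  y≮j rewrite bump-below x<j | bump-above (≮⇒≥ y≮j) = m<n⇒m<1+n x<y
... | no  x≮j | yes y<j = contradiction (<-trans x<y y<j) x≮j
... | no  x≮j | no  y≮j rewrite bump-above (≮⇒≥ x≮j) | bump-above (≮⇒≥ y≮j) = s<s x<y

bump-mono-≤ : ∀ j {x y} → x ≤ y → bump j x ≤ bump j y
bump-mono-≤ j x≤y with m≤n⇒m<n∨m≡n x≤y
... | inj₁ x<y  = <⇒≤ (bump-mono-< j x<y)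
... | inj₂ refl = ≤-refl

bump-reflects-< : ∀ j {x y} → bump j x < bump j y → x < y
bump-reflects-< j {x} {y} p with x <? y
... | yes x<y = x<y
... | no  x≮y = contradiction (bump-mono-≤ j (≮⇒≥ x≮y)) (<⇒≱ p)

bump-<ᵇ : ∀ j x y → (bump j x <ᵇ bump j y) ≡ (x <ᵇ y)
bump-<ᵇ j x y with x <? y
... | yes x<y = trans (<ᵇ-true (bump-mono-< j x<y)) (sym (<ᵇ-true x<y))
... | no  x≮y = trans (<ᵇ-false (bump-mono-≤ j (≮⇒≥ x≮y))) (sym (<ᵇ-false (≮⇒≥ x≮y)))

bump-below⁻ : ∀ {j x} → bump j x < j → x < j
bump-below⁻ {j} {x} p with x <? j
... | yes x<j = x<j
... | no  x≮j rewrite bump-above (≮⇒≥ x≮j) = <-trans (n<1+n x) p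

bump-above⁻ : ∀ {j x} → j < bump j x → j ≤ x
bump-above⁻ {j} {x} p with x <? j
... | yes x<j rewrite bump-below x<j = contradiction x<j (<-asym p)
... | no  x≮j = ≮⇒≥ x≮j

bump-fixes-below : ∀ {j} L → All (_< j) L → map (bump j) L ≡ L
bump-fixes-below L below = trans (map-cong-local {g = λ v → v} (All.map bump-below below)) (map-id L)

at-++ˡ : ∀ xs ys i → i < length xs → at (xs ++ ys) i ≡ at xs i
at-++ˡ (x ∷ xs) ys zero    _     = refl
at-++ˡ (x ∷ xs) ys (suc i) i<len = at-++ˡ xs ys i (s<s⁻¹ i<len)

at-++-length : ∀ xs y ys → at (xs ++ y ∷ ys) (length xs) ≡ y
at-++-length []       y ys = refl
at-++-length (x ∷ xs) y ys = at-++-length xs y ys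

at-map : ∀ (f : ℕ → ℕ) xs i → i < length xs → at (map f xs) i ≡ f (at xs i)
at-map f (x ∷ xs) zero    _     = refl
at-map f (x ∷ xs) (suc i) i<len = at-map f xs i (s<s⁻¹ i<len)

at-∈ : ∀ xs i → i < length xs → at xs i ∈ xs
at-∈ (x ∷ xs) zero    _     = here refl
at-∈ (x ∷ xs) (suc i) i<len = there (at-∈ xs i (s<s⁻¹ i<len))

∈⇒at : ∀ {v} xs → v ∈ xs → Σ ℕ λ i → i < length xs × at xs i ≡ v
∈⇒at (x ∷ xs) (here refl) = 0 , s≤s z≤n , refl
∈⇒at (x ∷ xs) (there v∈xs) with ∈⇒at xs v∈xs
... | i , i<len , eq = suc i , s≤s i<len , eq

at-injective : ∀ xs → Unique xs → ∀ {i k} → i < k → k < length xs → at xs i ≢ at xs k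
at-injective (x ∷ xs) (x∉xs ∷ _) {zero}  {suc k} _   k<len = All.lookup x∉xs (at-∈ xs k (s<s⁻¹ k<len))
at-injective (x ∷ xs) (_ ∷ uniq) {suc i} {suc k} i<k k<len = at-injective xs uniq (s<s⁻¹ i<k) (s<s⁻¹ k<len)

lastEntry-at : ∀ x xs → at (x ∷ xs) (length xs) ≡ lastEntry (x ∷ xs)
lastEntry-at x []       = refl
lastEntry-at x (y ∷ xs) = lastEntry-at y xs

lastEntry-snoc : ∀ xs y → lastEntry (xs ++ [ y ]) ≡ y
lastEntry-snoc []            y = refl
lastEntry-snoc (x ∷ [])      y = refl
lastEntry-snoc (x ∷ x′ ∷ xs) y = lastEntry-snoc (x′ ∷ xs) y

lastEntry-map : ∀ (f : ℕ → ℕ) x xs → lastEntry (map f (x ∷ xs)) ≡ f (lastEntry (x ∷ xs))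
lastEntry-map f x []       = refl
lastEntry-map f x (y ∷ xs) = lastEntry-map f y xs

length-append : ∀ π j → length (append π j) ≡ suc (length π)
length-append π j =
  trans (length-++ (map (bump j) π)) (trans (cong (_+ 1) (length-map (bump j) π)) (+-comm (length π) 1))

at-append-init : ∀ π j {i} → i < length π → at (append π j) i ≡ bump j (at π i)
at-append-init π j {i} i<len =
  trans (at-++ˡ (map (bump j) π) [ j ] i (subst (i <_) (sym (length-map (bump j) π)) i<len))
        (at-map (bump j) π i i<len)

at-append-last : ∀ π j → at (append π j) (length π) ≡ j
at-append-last π j =
  subst (λ m → at (append π j) m ≡ j) (length-map (bump j) π) (at-++-length (map (bump j) π) j [])

append-reflects-< : ∀ π j {i k} → i < length π → k < length π →
  at (append π j) i < at (append π j) k → at π i < at π k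
append-reflects-< π j i<len k<len p =
  bump-reflects-< j (subst₂ _<_ (at-append-init π j i<len) (at-append-init π j k<len) p)

append-preserves-< : ∀ π j {i k} → i < length π → k < length π →
  at π i < at π k → at (append π j) i < at (append π j) k
append-preserves-< π j i<len k<len p =
  subst₂ _<_ (sym (at-append-init π j i<len)) (sym (at-append-init π j k<len)) (bump-mono-< j p)

maxOf : List ℕ → ℕ
maxOf = foldr _⊔_ 0

≤-maxOf : ∀ {v} L → v ∈ L → v ≤ maxOf L
≤-maxOf (y ∷ L) (here refl) = m≤m⊔n y (maxOf L)
≤-maxOf (y ∷ L) (there v∈L) = ≤-trans (≤-maxOf L v∈L) (m≤n⊔m y (maxOf L))

maxOf-attained : ∀ L → maxOf L ≡ 0 ⊎ maxOf L ∈ L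
maxOf-attained [] = inj₁ refl
maxOf-attained (y ∷ L) with ⊔-sel y (maxOf L)
... | inj₁ eq rewrite eq = inj₂ (here refl)
... | inj₂ eq rewrite eq with maxOf-attained L
...   | inj₁ max≡0 = inj₁ max≡0
...   | inj₂ ∈L   = inj₂ (there ∈L)

maxOf-++ : ∀ A B → maxOf (A ++ B) ≡ maxOf A ⊔ maxOf B
maxOf-++ []      B = refl
maxOf-++ (a ∷ A) B rewrite maxOf-++ A B = sym (⊔-assoc a (maxOf A) (maxOf B))

maxOf-map : ∀ {f : ℕ → ℕ} → (∀ {x y} → x ≤ y → f x ≤ f y) → f 0 ≡ 0 →
  ∀ L → maxOf (map f L) ≡ f (maxOf L)
maxOf-map mono f0 []      = sym f0
maxOf-map mono f0 (a ∷ L) rewrite maxOf-map mono f0 L = sym (mono-≤-distrib-⊔ mono a (maxOf L))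

IsAscent : List ℕ → ℕ → Set
IsAscent π i = suc i < length π × at π i < at π (suc i)

ascent-cons : ∀ {a π v} → (Σ ℕ λ i → IsAscent π i × at π i ≡ v) → Σ ℕ λ i → IsAscent (a ∷ π) i × at (a ∷ π) i ≡ v
ascent-cons (i , (i+1<len , asc) , eq) = suc i , (s≤s i+1<len , asc) , eq

ascentTop⇒ascent : ∀ {v} π → v ∈ ascentTops π → Σ ℕ λ i → IsAscent π i × at π i ≡ v
ascentTop⇒ascent {v} (a ∷ b ∷ π) v∈ with a <ᵇ b | <ᵇ-reflects-< a b | ascentTop⇒ascent {v} (b ∷ π)
ascentTop⇒ascent (a ∷ b ∷ π) (here refl) | true  | ofʸ a<b | _   = 0 , (s≤s (s≤s z≤n) , a<b) , refl
ascentTop⇒ascent (a ∷ b ∷ π) (there v∈)  | true  | _       | rec = ascent-cons (rec v∈)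
ascentTop⇒ascent (a ∷ b ∷ π) v∈          | false | _       | rec = ascent-cons (rec v∈)

ascent⇒ascentTop : ∀ π i → IsAscent π i → at π i ∈ ascentTops π
ascent⇒ascentTop (a ∷ b ∷ π) zero    (_ , a<b) rewrite <ᵇ-true a<b = here refl
ascent⇒ascentTop (a ∷ b ∷ π) (suc i) (i+1<len , asc) with a <ᵇ b
... | true  = there (ascent⇒ascentTop (b ∷ π) i (s<s⁻¹ i+1<len , asc))
... | false = ascent⇒ascentTop (b ∷ π) i (s<s⁻¹ i+1<len , asc)

ascent≤s : ∀ π i → IsAscent π i → at π i ≤ s π
ascent≤s π i asc = ≤-maxOf (ascentTops π) (ascent⇒ascentTop π i asc)

s-attained : ∀ π → 0 < s π → Σ ℕ λ i → IsAscent π i × at π i ≡ s π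
s-attained π 0<s with maxOf-attained (ascentTops π)
... | inj₁ s≡0 = contradiction (sym s≡0) (<⇒≢ 0<s)
... | inj₂ s∈  = ascentTop⇒ascent π s∈

ascentTops-map : ∀ (f : ℕ → ℕ) → (∀ x y → (f x <ᵇ f y) ≡ (x <ᵇ y)) →
  ∀ π → ascentTops (map f π) ≡ map f (ascentTops π)
ascentTops-map f f-<ᵇ []           = refl
ascentTops-map f f-<ᵇ (x ∷ [])     = refl
ascentTops-map f f-<ᵇ (x ∷ y ∷ π) rewrite ascentTops-map f f-<ᵇ (y ∷ π) | f-<ᵇ x y with x <ᵇ y
... | true  = refl
... | false = refl

newAscent : ℕ → ℕ → List ℕ
newAscent r y = if r <ᵇ y then [ r ] else []

ascentTops-snoc : ∀ x π y →
  ascentTops ((x ∷ π) ++ [ y ]) ≡ ascentTops (x ∷ π) ++ newAscent (lastEntry (x ∷ π)) y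
ascentTops-snoc x []      y with x <ᵇ y
... | true  = refl
... | false = refl
ascentTops-snoc x (x′ ∷ π) y rewrite ascentTops-snoc x′ π y with x <ᵇ x′
... | true  = refl
... | false = refl

s-append : ∀ x π j → 0 < j →
  s (append (x ∷ π) j) ≡ bump j (s (x ∷ π)) ⊔ maxOf (newAscent (bump j (lastEntry (x ∷ π))) j)
s-append x π j 0<j =
  begin
    maxOf (ascentTops (map (bump j) (x ∷ π) ++ [ j ]))
  ≡⟨ cong maxOf (ascentTops-snoc (bump j x) (map (bump j) π) j) ⟩
    maxOf (ascentTops (map (bump j) (x ∷ π)) ++ newAscent (lastEntry (map (bump j) (x ∷ π))) j)
  ≡⟨ maxOf-++ (ascentTops (map (bump j) (x ∷ π))) _ ⟩
    maxOf (ascentTops (map (bump j) (x ∷ π))) ⊔ maxOf (newAscent (lastEntry (map (bump j) (x ∷ π))) j)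
  ≡⟨ cong₂ _⊔_ (cong maxOf (ascentTops-map (bump j) (bump-<ᵇ j) (x ∷ π)))
               (cong (λ r → maxOf (newAscent r j)) (lastEntry-map (bump j) x π)) ⟩
    maxOf (map (bump j) (ascentTops (x ∷ π))) ⊔ maxOf (newAscent (bump j (lastEntry (x ∷ π))) j)
  ≡⟨ cong (_⊔ maxOf (newAscent (bump j (lastEntry (x ∷ π))) j)) (maxOf-map (bump-mono-≤ j) (bump-below 0<j) (ascentTops (x ∷ π))) ⟩
    bump j (s (x ∷ π)) ⊔ maxOf (newAscent (bump j (lastEntry (x ∷ π))) j)
  ∎ where open ≡-Reasoning

-- Appending j ≤ r (r the last entry) creates no ascent.
s-append-low : ∀ x π j → 0 < j → j ≤ lastEntry (x ∷ π) → s (append (x ∷ π) j) ≡ bump j (s (x ∷ π))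
s-append-low x π j 0<j j≤r
  rewrite s-append x π j 0<j | bump-above j≤r | <ᵇ-false {suc (lastEntry (x ∷ π))} (m≤n⇒m≤1+n j≤r)
  = ⊔-identityʳ _

s-append-next : ∀ x π → let r = lastEntry (x ∷ π) in
  s (append (x ∷ π) (suc r)) ≡ bump (suc r) (s (x ∷ π)) ⊔ r
s-append-next x π
  rewrite s-append x π (suc (lastEntry (x ∷ π))) (s≤s z≤n)
        | bump-below {suc (lastEntry (x ∷ π))} ≤-refl
        | <ᵇ-true {lastEntry (x ∷ π)} ≤-refl
  = cong (bump (suc (lastEntry (x ∷ π))) (s (x ∷ π)) ⊔_) (⊔-identityʳ (lastEntry (x ∷ π)))

oneTo : ℕ → List ℕ
oneTo n = map suc (upTo n)

∈-oneTo⁻ : ∀ {n v} → v ∈ oneTo n → 1 ≤ v × v ≤ n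
∈-oneTo⁻ v∈ with ∈-map⁻ suc v∈
... | _ , u∈ , refl = s≤s z≤n , ∈-upTo⁻ u∈

∈-oneTo⁺ : ∀ {n v} → 1 ≤ v → v ≤ n → v ∈ oneTo n
∈-oneTo⁺ {v = suc v} _ v<n = ∈-map⁺ suc (∈-upTo⁺ v<n)

oneTo-unique : ∀ n → Unique (oneTo n)
oneTo-unique n = Unique.map⁺ suc-injective (Unique.upTo⁺ n)

oneTo-suc : ∀ n → oneTo (suc n) ≡ oneTo n ++ [ suc n ]
oneTo-suc n = trans (cong (map suc) (sym (upTo-∷ʳ n))) (map-++ suc (upTo n) [ n ])

oneTo-suc² : ∀ n → oneTo (suc (suc n)) ≡ oneTo n ++ (suc n ∷ suc (suc n) ∷ [])
oneTo-suc² n =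
  begin
    oneTo (suc (suc n))
  ≡⟨ oneTo-suc (suc n) ⟩
    oneTo (suc n) ++ [ suc (suc n) ]
  ≡⟨ cong (_++ [ suc (suc n) ]) (oneTo-suc n) ⟩
    (oneTo n ++ [ suc n ]) ++ [ suc (suc n) ]
  ≡⟨ ++-assoc (oneTo n) [ suc n ] [ suc (suc n) ] ⟩
    oneTo n ++ (suc n ∷ suc (suc n) ∷ [])
  ∎ where open ≡-Reasoning

perm-∈ : ∀ {n π v} → IsPerm n π → v ∈ π → 1 ≤ v × v ≤ n
perm-∈ perm v∈ = ∈-oneTo⁻ (∈-resp-↭ perm v∈)

∈-perm : ∀ {n π v} → IsPerm n π → 1 ≤ v → v ≤ n → v ∈ π
∈-perm perm 1≤v v≤n = ∈-resp-↭ (↭-sym perm) (∈-oneTo⁺ 1≤v v≤n)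

perm-unique : ∀ {n π} → IsPerm n π → Unique π
perm-unique {n} perm = Unique-resp-↭ (↭⇒↭ₛ (↭-sym perm)) (oneTo-unique n)

oneTo-append : ∀ n j → 1 ≤ j → j ≤ suc n → append (oneTo n) j ↭ oneTo (suc n)
oneTo-append n j 1≤j j≤1+n with m≤n⇒m<n∨m≡n j≤1+n
... | inj₂ refl
  rewrite bump-fixes-below (oneTo n) (All.tabulate λ v∈ → s≤s (proj₂ (∈-oneTo⁻ v∈)))
  = ↭-reflexive (sym (oneTo-suc n))
oneTo-append zero    j 1≤j _ | inj₁ (s≤s j≤0) = contradiction j≤0 (<⇒≱ 1≤j)
oneTo-append (suc m) j 1≤j _ | inj₁ (s≤s j≤m+1) =
  begin
    map (bump j) (oneTo (suc m)) ++ [ j ]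
  ≡⟨ cong (λ l → map (bump j) l ++ [ j ]) (oneTo-suc m) ⟩
    map (bump j) (oneTo m ++ [ suc m ]) ++ [ j ]
  ≡⟨ cong (_++ [ j ]) (map-++ (bump j) (oneTo m) [ suc m ]) ⟩
    (map (bump j) (oneTo m) ++ [ bump j (suc m) ]) ++ [ j ]
  ≡⟨ ++-assoc (map (bump j) (oneTo m)) _ _ ⟩
    map (bump j) (oneTo m) ++ (bump j (suc m) ∷ j ∷ [])
  ≡⟨ cong (λ v → map (bump j) (oneTo m) ++ (v ∷ j ∷ [])) (bump-above j≤m+1) ⟩
    map (bump j) (oneTo m) ++ (suc (suc m) ∷ j ∷ [])
  ↭⟨ ++⁺ˡ (map (bump j) (oneTo m)) (swap (suc (suc m)) j ↭-refl) ⟩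
    map (bump j) (oneTo m) ++ (j ∷ suc (suc m) ∷ [])
  ≡⟨ sym (++-assoc (map (bump j) (oneTo m)) [ j ] _) ⟩
    append (oneTo m) j ++ [ suc (suc m) ]
  ↭⟨ ++⁺ʳ [ suc (suc m) ] (oneTo-append m j 1≤j j≤m+1) ⟩
    oneTo (suc m) ++ [ suc (suc m) ]
  ≡⟨ sym (oneTo-suc (suc m)) ⟩
    oneTo (suc (suc m))
  ∎ where open PermutationReasoning

append-perm : ∀ {n π j} → IsPerm n π → 1 ≤ j → j ≤ suc n → IsPerm (suc n) (append π j)
append-perm {n} {π} {j} perm 1≤j j≤1+n = ↭-trans (++⁺ʳ [ j ] (map⁺ (bump j) perm)) (oneTo-append n j 1≤j j≤1+n)

module InClass {n x : ℕ} {xs : List ℕ} (π∈C : C n (x ∷ xs)) where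

  π : List ℕ
  π = x ∷ xs

  L N r : ℕ
  L = length xs
  N = length π
  r = lastEntry π

  perm : IsPerm n π
  perm = proj₁ π∈C

  av213 : Avoids213 π
  av213 = proj₁ (proj₂ π∈C)

  av3421 : Avoids34-21 π
  av3421 = proj₂ (proj₂ π∈C)

  r-at : at π L ≡ r
  r-at = lastEntry-at x xs

  r-range : 1 ≤ r × r ≤ n
  r-range = perm-∈ perm (subst (_∈ π) r-at (at-∈ π L ≤-refl))

  position-of : ∀ {v} → 1 ≤ v → v ≤ n → Σ ℕ λ p → p < N × at π p ≡ v
  position-of 1≤v v≤n = ∈⇒at π (∈-perm perm 1≤v v≤n)

  before-last : ∀ {p v} → p < N → at π p ≡ v → v ≢ r → p < L
  before-last p<N πp≡v v≢r with m<1+n⇒m<n∨m≡n p<N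
  ... | inj₁ p<L  = p<L
  ... | inj₂ refl = contradiction (trans (sym πp≡v) r-at) v≢r

  -- The larger entry of an inversion exceeds r: otherwise the inversion
  -- followed by the last entry would be an occurrence of 2-1-3.
  inversion-above-last : ∀ {i l} → i < l → l < N → at π l < at π i → r < at π i
  inversion-above-last {i} {l} i<l l<N πl<πi with <-cmp (at π i) r
  ... | tri> _ _ r<πi = r<πi
  ... | tri≈ _ πi≡r _ =
    contradiction (trans πi≡r (sym r-at)) (at-injective π (perm-unique perm) (<-≤-trans i<l (s≤s⁻¹ l<N)) ≤-refl)
  ... | tri< πi<r _ _ with m<1+n⇒m<n∨m≡n l<N
  ...   | inj₁ l<L  = contradiction (πl<πi , subst (at π i <_) (sym r-at) πi<r) (av213 i l L i<l l<L ≤-refl)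
  ...   | inj₂ refl = contradiction (subst (_< at π i) r-at πl<πi) (<-asym πi<r)

  -- The entry r-1 (if positive) is an ascent top: the entry after it is not
  -- smaller, by inversion-above-last.
  pred-last≤s : ∀ {v} → 1 ≤ v → suc v ≡ r → v ≤ s π
  pred-last≤s {v} 1≤v v+1≡r with position-of 1≤v (≤-trans (n≤1+n v) (subst (_≤ n) (sym v+1≡r) (proj₂ r-range)))
  ... | p , p<N , πp≡v with before-last p<N πp≡v (λ v≡r → 1+n≢n (trans v+1≡r (sym v≡r)))
  ...   | p<L with <-cmp (at π p) (at π (suc p))
  ...     | tri< asc _ _ = subst (_≤ s π) πp≡v (ascent≤s π p (s≤s p<L , asc))
  ...     | tri≈ _ eq _ = contradiction eq (at-injective π (perm-unique perm) (n<1+n p) (s≤s p<L))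
  ...     | tri> _ _ desc =
    contradiction (subst (r <_) πp≡v (inversion-above-last (n<1+n p) (s≤s p<L) desc))
                  (<-asym (subst (v <_) v+1≡r (n<1+n v)))

  last≤1+s : r ≤ suc (s π)
  last≤1+s = bound r refl
    where
    bound : ∀ v → v ≡ r → v ≤ suc (s π)
    bound zero          _    = z≤n
    bound (suc zero)    _    = s≤s z≤n
    bound (suc (suc k)) k+2≡r = s≤s (pred-last≤s (s≤s z≤n) k+2≡r)

  last-after-s : s π < r → r ≡ suc (s π)
  last-after-s s<r = ≤-antisym last≤1+s s<r

  -- If r < s(π), the ascent realising s(π) is an ascent above r that ends
  -- strictly before the last position.
  ascent-above-last : r < s π → Σ ℕ λ i → suc i < L × r < at π i × at π i < at π (suc i)
  ascent-above-last r<s with s-attained π (<-≤-trans (s≤s z≤n) (≤-<-trans (proj₁ r-range) r<s))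
  ... | i , (i+1<N , asc) , πi≡s with m<1+n⇒m<n∨m≡n i+1<N
  ...   | inj₁ i+1<L = i , i+1<L , subst (r <_) (sym πi≡s) r<s , asc
  ...   | inj₂ i+1≡L = contradiction (subst₂ _<_ πi≡s (trans (cong (at π) i+1≡L) r-at) asc) (<-asym r<s)

  child-position : ∀ {j k} → k < length (append π j) → k < N ⊎ k ≡ N
  child-position {j} {k} k<len = m<1+n⇒m<n∨m≡n (subst (k <_) (length-append π j) k<len)

  -- A new 2-1-3 must end at position N with some inversion of π below j,
  -- impossible for j ≤ r+1.
  avoid213-child : ∀ {j} → j ≤ suc r → Avoids213 (append π j)
  avoid213-child {j} j≤1+r i l k i<l l<k k<len (σl<σi , σi<σk) with child-position {j} k<len
  ... | inj₁ k<N =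
    av213 i l k i<l l<k k<N (append-reflects-< π j l<N i<N σl<σi , append-reflects-< π j i<N k<N σi<σk)
    where
    l<N : l < N
    l<N = <-trans l<k k<N
    i<N : i < N
    i<N = <-trans i<l l<N
  ... | inj₂ refl = <⇒≱ (≤-<-trans (inversion-above-last i<l l<k πl<πi) πi<j) j≤1+r
    where
    πl<πi : at π l < at π i
    πl<πi = append-reflects-< π j l<k (<-trans i<l l<k) σl<σi
    πi<j : at π i < j
    πi<j = bump-below⁻ (subst₂ _<_ (at-append-init π j (<-trans i<l l<k)) (at-append-last π j) σi<σk)

  -- For r+1 < j ≤ n+1, the entries r+1, r, j at positions p < L < N form a 2-1-3.
  avoid213-child⇒ : ∀ {j} → j ≤ suc n → Avoids213 (append π j) → j ≤ suc r
  avoid213-child⇒ {j} j≤1+n av with suc r <? j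
  ... | no  r+1≮j = ≮⇒≥ r+1≮j
  ... | yes r+1<j with position-of (s≤s z≤n) (s<s⁻¹ (<-≤-trans r+1<j j≤1+n))
  ...   | p , p<N , πp≡r+1 = contradiction (σL<σp , σp<σN) (av p L N p<L ≤-refl (subst (N <_) (sym (length-append π j)) ≤-refl))
    where
    p<L : p < L
    p<L = before-last p<N πp≡r+1 1+n≢n
    σL<σp : at (append π j) L < at (append π j) p
    σL<σp = append-preserves-< π j ≤-refl p<N (subst₂ _<_ (sym r-at) (sym πp≡r+1) ≤-refl)
    σp<σN : at (append π j) p < at (append π j) N
    σp<σN = subst₂ _<_ (sym (trans (at-append-init π j p<N) (trans (cong (bump j) πp≡r+1) (bump-below r+1<j))))
                        (sym (at-append-last π j)) r+1<j

  -- A new 34-21 must end with r, j at positions L, N (so j ≤ r) after an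
  -- ascent above r, which exists only if r < s(π).
  avoid3421-child : ∀ {j} → (r < s π → r < j) → Avoids34-21 (append π j)
  avoid3421-child {j} cond i k i+1<k k+1<len (σk+1<σk , σk<σi , σi<σi+1) with child-position {j} k+1<len
  ... | inj₁ k+1<N =
    av3421 i k i+1<k k+1<N (append-reflects-< π j k+1<N k<N σk+1<σk ,
                            append-reflects-< π j k<N i<N σk<σi ,
                            append-reflects-< π j i<N i+1<N σi<σi+1)
    where
    k<N : k < N
    k<N = <-trans (n<1+n k) k+1<N
    i+1<N : suc i < N
    i+1<N = <-trans i+1<k k<N
    i<N : i < N
    i<N = <-trans (n<1+n i) i+1<N
  ... | inj₂ refl = contradiction j≤r (<⇒≱ (cond (<-≤-trans r<πi (ascent≤s π i (i+1<N , πi<πi+1)))))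
    where
    i+1<N : suc i < N
    i+1<N = <-trans i+1<k ≤-refl
    i<N : i < N
    i<N = <-trans (n<1+n i) i+1<N
    j≤r : j ≤ r
    j≤r = bump-above⁻ (subst₂ _<_ (at-append-last π j) (trans (at-append-init π j ≤-refl) (cong (bump j) r-at)) σk+1<σk)
    r<πi : r < at π i
    r<πi = subst (_< at π i) r-at (append-reflects-< π j ≤-refl i<N σk<σi)
    πi<πi+1 : at π i < at π (suc i)
    πi<πi+1 = append-reflects-< π j i<N i+1<N σi<σi+1

  -- For j ≤ r < s(π), an ascent above r followed by r, j is a 34-21.
  avoid3421-child⇒ : ∀ {j} → Avoids34-21 (append π j) → r < s π → r < j
  avoid3421-child⇒ {j} av r<s with r <? j
  ... | yes r<j = r<j
  ... | no  r≮j with ascent-above-last r<s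
  ...   | i , i+1<L , r<πi , asc =
    contradiction (σN<σL , σL<σi , append-preserves-< π j i<N i+1<N asc)
                  (av i L i+1<L (subst (N <_) (sym (length-append π j)) ≤-refl))
    where
    i+1<N : suc i < N
    i+1<N = <-trans i+1<L ≤-refl
    i<N : i < N
    i<N = <-trans (n<1+n i) i+1<N
    σL≡r+1 : at (append π j) L ≡ suc r
    σL≡r+1 = trans (at-append-init π j ≤-refl) (trans (cong (bump j) r-at) (bump-above (≮⇒≥ r≮j)))
    σN<σL : at (append π j) N < at (append π j) L
    σN<σL = subst₂ _<_ (sym (at-append-last π j)) (sym σL≡r+1) (s≤s (≮⇒≥ r≮j))
    σL<σi : at (append π j) L < at (append π j) i
    σL<σi = append-preserves-< π j ≤-refl i<N (subst (_< at π i) (sym r-at) r<πi)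

  child⇔ : ∀ {j} → 1 ≤ j → j ≤ suc n → C (suc n) (append π j) ⇔ (j ≤ suc r × (r < s π → r < j))
  child⇔ 1≤j j≤1+n = mk⇔
    (λ (_ , σ213 , σ3421) → avoid213-child⇒ j≤1+n σ213 , avoid3421-child⇒ σ3421)
    (λ (j≤1+r , cond) → append-perm perm 1≤j j≤1+n , avoid213-child j≤1+r , avoid3421-child cond)

  label-child : ∀ j → label (append π j) ≡ (s (append π j) , j)
  label-child j = cong (s (append π j) ,_) (lastEntry-snoc (map (bump j) π) j)

  label-low : ∀ {j} → 1 ≤ j → j ≤ r → j ≤ s π → label (append π j) ≡ (suc (s π) , j)
  label-low {j} 1≤j j≤r j≤s =
    trans (label-child j) (cong (_, j) (trans (s-append-low x xs j 1≤j j≤r) (bump-above j≤s)))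

  label-mid : ∀ {j} → 1 ≤ j → j ≤ r → s π < j → label (append π j) ≡ (s π , j)
  label-mid {j} 1≤j j≤r s<j =
    trans (label-child j) (cong (_, j) (trans (s-append-low x xs j 1≤j j≤r) (bump-below s<j)))

  label-next : label (append π (suc r)) ≡ (bump (suc r) (s π) ⊔ r , suc r)
  label-next = trans (label-child (suc r)) (cong (_, suc r) (s-append-next x xs))

  -- Case s(π) < r: the children are j = 1, …, r+1, and r = s(π)+1.
  children-when-s<r : s π < r → ChildLabelsAre n π
    (map (λ i → (suc (s π) , i)) (oneTo (s π)) ++ ((s π , suc (s π)) ∷ (r , suc r) ∷ []))
  children-when-s<r s<r =
    oneTo (suc r) , (oneTo-unique (suc r) , λ j → mk⇔ (to j) (from j)) , ↭-reflexive labels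
    where
    S : ℕ
    S = s π
    to : ∀ j → j ∈ oneTo (suc r) → (1 ≤ j × j ≤ suc n) × C (suc n) (append π j)
    to j j∈ with ∈-oneTo⁻ j∈
    ... | 1≤j , j≤1+r = (1≤j , j≤1+n) , Equivalence.from (child⇔ 1≤j j≤1+n) (j≤1+r , λ r<s → contradiction s<r (<-asym r<s))
      where
      j≤1+n : j ≤ suc n
      j≤1+n = ≤-trans j≤1+r (s≤s (proj₂ r-range))
    from : ∀ j → (1 ≤ j × j ≤ suc n) × C (suc n) (append π j) → j ∈ oneTo (suc r)
    from j ((1≤j , j≤1+n) , σ∈C) = ∈-oneTo⁺ 1≤j (proj₁ (Equivalence.to (child⇔ 1≤j j≤1+n) σ∈C))
    children : oneTo (suc r) ≡ oneTo S ++ (suc S ∷ suc r ∷ [])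
    children rewrite last-after-s s<r = oneTo-suc² S
    lowLabel : ∀ {j} → j ∈ oneTo S → label (append π j) ≡ (suc S , j)
    lowLabel j∈ with ∈-oneTo⁻ j∈
    ... | 1≤j , j≤S = label-low 1≤j (≤-trans j≤S (<⇒≤ s<r)) j≤S
    labels : map (λ j → label (append π j)) (oneTo (suc r)) ≡
             map (λ i → (suc S , i)) (oneTo S) ++ ((S , suc S) ∷ (r , suc r) ∷ [])
    labels =
      begin
        map (λ j → label (append π j)) (oneTo (suc r))
      ≡⟨ cong (map (λ j → label (append π j))) children ⟩
        map (λ j → label (append π j)) (oneTo S ++ (suc S ∷ suc r ∷ []))
      ≡⟨ map-++ (λ j → label (append π j)) (oneTo S) _ ⟩
        map (λ j → label (append π j)) (oneTo S) ++ (label (append π (suc S)) ∷ label (append π (suc r)) ∷ [])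
      ≡⟨ cong₂ _++_ (map-cong-local (All.tabulate lowLabel))
                    (cong₂ (λ a b → a ∷ b ∷ []) (label-mid (s≤s z≤n) s<r ≤-refl) label-r+1) ⟩
        map (λ i → (suc S , i)) (oneTo S) ++ ((S , suc S) ∷ (r , suc r) ∷ [])
      ∎
      where
      open ≡-Reasoning
      label-r+1 : label (append π (suc r)) ≡ (r , suc r)
      label-r+1 = trans label-next
        (cong (_, suc r) (trans (cong (_⊔ r) (bump-below (m<n⇒m<1+n s<r))) (m≤n⇒m⊔n≡n (<⇒≤ s<r))))

  -- Case r < s(π): the only child is j = r+1, and it raises s by one.
  children-when-r<s : r < s π → ChildLabelsAre n π ((suc (s π) , suc r) ∷ [])
  children-when-r<s r<s =
    [ suc r ] , ((All.[] ∷ []) , λ j → mk⇔ (to j) (from j)) , ↭-reflexive (cong [_] label-r+1)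
    where
    to : ∀ j → j ∈ [ suc r ] → (1 ≤ j × j ≤ suc n) × C (suc n) (append π j)
    to j (here refl) = (s≤s z≤n , s≤s (proj₂ r-range)) ,
      Equivalence.from (child⇔ (s≤s z≤n) (s≤s (proj₂ r-range))) (≤-refl , λ _ → ≤-refl)
    from : ∀ j → (1 ≤ j × j ≤ suc n) × C (suc n) (append π j) → j ∈ [ suc r ]
    from j ((1≤j , j≤1+n) , σ∈C) with Equivalence.to (child⇔ 1≤j j≤1+n) σ∈C
    ... | j≤1+r , cond = here (≤-antisym j≤1+r (cond r<s))
    label-r+1 : label (append π (suc r)) ≡ (suc (s π) , suc r)
    label-r+1 = trans label-next
      (cong (_, suc r) (trans (cong (_⊔ r) (bump-above r<s)) (m≥n⇒m⊔n≡m (<⇒≤ (m<n⇒m<1+n r<s)))))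

root∈C : C 1 (1 ∷ [])
root∈C = ↭-refl , no213 , no3421
  where
  no213 : Avoids213 (1 ∷ [])
  no213 _ _ zero    _ ()  _
  no213 _ _ (suc k) _ _   (s≤s ())
  no3421 : Avoids34-21 (1 ∷ [])
  no3421 _ _ _ (s≤s ())

-- The theorem; for the empty list s = lastEntry = 0, so both hypotheses fail.
lemma3p5 : (C 1 (1 ∷ []) × label (1 ∷ []) ≡ (0 , 1))
    × (∀ n π → C n π →
        (s π < lastEntry π →
          ChildLabelsAre n π
            (map (λ i → (suc (s π) , i)) (map suc (upTo (s π)))
              ++ ((s π , suc (s π)) ∷ (lastEntry π , suc (lastEntry π)) ∷ [])))
        × (lastEntry π < s π →
          ChildLabelsAre n π ((suc (s π) , suc (lastEntry π)) ∷ [])))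
lemma3p5 = (root∈C , refl) , λ where
  n []       _   → (λ ()) , (λ ())
  n (x ∷ xs) π∈C → InClass.children-when-s<r π∈C , InClass.children-when-r<s π∈C
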